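{- Let $G=(V,E)$ be a graph with edge weights $w\colon E\to\mathbb{R}_{>0}$ taking only integer values, let $s,t$ be vertices of $G$, and let $C$ be an integer. Then for every $\alpha\in[0,1)$, the instance $(G,w,s,t,C)$ of \textsc{Minimum Installation Path} has a positive answer if and only if the instance $(G,w,s,t,C+\alpha)$ has a positive answer.
   Context: \textsc{Minimum Installation Path}$(G,w,s,t,C)$ asks whether there is $p\colon V\to\mathbb{R}_{\ge0}$ with $\sum_{v\in V}p(v)\le C$ such that the edges $\{uv\in E\mid p(u)+p(v)\ge w(uv)\}$ contain an $s$-$t$ path. -}

module Defs where

open import Level using (0ℓ)
open import Data.Nat as ℕ using (ℕ; zero; suc)
open import Data.Integer as ℤ using (ℤ; +_; -[1+_])
open import Data.Fin using (Fin)
open import Data.List using (List; []; _∷_)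
open import Data.List.Relation.Unary.Unique.Propositional using (Unique)
open import Data.Product using (Σ; ∃; ∃-syntax; _×_; _,_)
open import Data.Sum using (_⊎_)
open import Relation.Binary.PropositionalEquality using (_≡_; _≢_)
open import Relation.Nullary using (¬_)

-- The real numbers, axiomatised as a Dedekind-complete ordered field
-- (these axioms characterise ℝ up to isomorphism).  The theorem is
-- stated for every model of these axioms.

record RealField : Set₁ where
  infixl 6 _+_
  infixl 7 _*_
  infix  4 _≤_
  field
    R    : Set
    0r   : R
    1r   : R
    _+_  : R → R → R
    _*_  : R → R → R
    -_   : R → R
    _≤_  : R → R → Set
    +-assoc     : ∀ x y z → (x + y) + z ≡ x + (y + z)
    +-comm      : ∀ x y → x + y ≡ y + x
    +-identityˡ : ∀ x → 0r + x ≡ x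
    +-inverseˡ  : ∀ x → (- x) + x ≡ 0r
    *-assoc     : ∀ x y z → (x * y) * z ≡ x * (y * z)
    *-comm      : ∀ x y → x * y ≡ y * x
    *-identityˡ : ∀ x → 1r * x ≡ x
    distribˡ    : ∀ x y z → x * (y + z) ≡ (x * y) + (x * z)
    0≢1         : 0r ≢ 1r
    *-inverse   : ∀ x → x ≢ 0r → ∃[ y ] (x * y ≡ 1r)
    ≤-refl      : ∀ x → x ≤ x
    ≤-trans     : ∀ {x y z} → x ≤ y → y ≤ z → x ≤ z
    ≤-antisym   : ∀ {x y} → x ≤ y → y ≤ x → x ≡ y
    ≤-total     : ∀ x y → x ≤ y ⊎ y ≤ x
    +-mono-≤    : ∀ {x y} z → x ≤ y → x + z ≤ y + z
    *-nonneg    : ∀ {x y} → 0r ≤ x → 0r ≤ y → 0r ≤ x * y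
    complete    : (P : R → Set) → ∃[ x ] P x → ∃[ b ] (∀ x → P x → x ≤ b) →
                  ∃[ s ] ((∀ x → P x → x ≤ s) ×
                          (∀ b → (∀ x → P x → x ≤ b) → s ≤ b))

  infix 4 _<_
  _<_ : R → R → Set
  x < y = x ≤ y × x ≢ y

  fromℕ : ℕ → R
  fromℕ zero    = 0r
  fromℕ (suc n) = 1r + fromℕ n

  fromℤ : ℤ → R
  fromℤ (+ n)      = fromℕ n
  fromℤ -[1+ n ]   = - fromℕ (suc n)

  sumFin : ∀ {n} → (Fin n → R) → R
  sumFin {zero}  f = 0r
  sumFin {suc n} f = f Fin.zero + sumFin (λ i → f (Fin.suc i))
    where import Data.Fin as Fin

record Graph (n : ℕ) : Set₁ where
  field
    Adj     : Fin n → Fin n → Set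
    Adj-sym : ∀ {u v} → Adj u v → Adj v u
    Adj-irr : ∀ {v} → ¬ Adj v v

data Walk {n : ℕ} (E : Fin n → Fin n → Set) : Fin n → Fin n → Set where
  here : ∀ {v} → Walk E v v
  step : ∀ {u v x} → E u v → Walk E v x → Walk E u x

vertices : ∀ {n} {E : Fin n → Fin n → Set} {u v} → Walk E u v → List (Fin n)
vertices (here {v})       = v ∷ []
vertices (step {u} _ wk)  = u ∷ vertices wk

record Path {n : ℕ} (E : Fin n → Fin n → Set) (s t : Fin n) : Set where
  field
    walk     : Walk E s t
    distinct : Unique (vertices walk)

module _ (ℝ : RealField) where
  open RealField ℝ

  Installed : ∀ {n} → Graph n → (Fin n → Fin n → ℕ) → (Fin n → R) →
              Fin n → Fin n → Set
  Installed G w p u v = Graph.Adj G u v × (fromℕ (w u v) ≤ p u + p v)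

  MinInstPath : ∀ {n} → Graph n → (Fin n → Fin n → ℕ) → Fin n → Fin n → R → Set
  MinInstPath {n} G w s t C =
    Σ (Fin n → R) λ p → (∀ v → 0r ≤ p v) × (sumFin p ≤ C) × Path (Installed G w p) s t

-- Round along the installed s-t path s = v₀, …, vₖ = t greedily: q(v₀) = 0 and
-- q(vᵢ₊₁) = w(vᵢvᵢ₊₁) ∸ q(vᵢ), the least natural number that installs the edge just
-- crossed (q is 0 off the path).  With the slack rᵢ = Σ_{j<i} (p(vⱼ) − q(vⱼ)) one
-- shows by induction that rᵢ ≥ 0 and q(vᵢ) ≤ p(vᵢ) + rᵢ, because p also installs
-- vᵢ₋₁vᵢ.  Hence Σ q ≤ Σ p ≤ C + α, and since Σ q is a natural number and α < 1,
-- Σ q ≤ C.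

module Submission where

open import Defs
open import Data.Nat using (ℕ; _≥_)
open import Data.Integer using (ℤ)
open import Data.Fin using (Fin)
open import Relation.Binary.PropositionalEquality using (_≡_)
open import Function.Bundles using (_⇔_)

open import Level using (0ℓ)
open import Data.Nat using (zero; suc; _∸_)
import Data.Nat as ℕ
import Data.Nat.Properties as ℕ
import Data.Integer as ℤ
open import Data.Integer using (-[1+_])
open import Data.Fin using (zero; suc; _≟_)
open import Data.Vec.Functional using (updateAt; tail)
open import Data.Vec.Functional.Properties using (updateAt-updates; updateAt-minimal)
open import Data.Product using (_×_; _,_; proj₁; ∃-syntax; Σ-syntax)
import Data.Product as Product
open import Data.Empty using (⊥-elim)
open import Data.Sum using (_⊎_; inj₁; inj₂)
open import Data.List using (_∷_)
open import Data.List.Relation.Unary.All as All using (All; _∷_)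
open import Data.List.Relation.Unary.Any using (here; there)
open import Data.List.Relation.Unary.AllPairs using (_∷_)
open import Data.List.Relation.Unary.Unique.Propositional using (Unique)
open import Data.List.Membership.Propositional using (_∈_)
open import Relation.Binary.PropositionalEquality
  using (_≢_; refl; sym; trans; cong; cong₂; subst; isEquivalence; ≢-sym)
open import Relation.Nullary using (yes; no)
open import Function.Base using (_∘_; const; id)
open import Function.Bundles using (mk⇔)
open import Algebra.Bundles using (CommutativeRing)
open import Relation.Binary.Bundles using (Poset)
import Algebra.Properties.Ring as RingProperties
import Algebra.Properties.CommutativeSemigroup as CommutativeSemigroupProperties
import Relation.Binary.Reasoning.PartialOrder as PosetReasoning

module OrderedFieldProperties (ℝ : RealField) where
  open RealField ℝ

  commutativeRing : CommutativeRing 0ℓ 0ℓ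
  commutativeRing = record
    { Carrier = R ; _≈_ = _≡_ ; _+_ = _+_ ; _*_ = _*_ ; -_ = -_ ; 0# = 0r ; 1# = 1r
    ; isCommutativeRing = record
      { isRing = record
        { +-isAbelianGroup = record
          { isGroup = record
            { isMonoid = record
              { isSemigroup = record
                { isMagma = record { isEquivalence = isEquivalence ; ∙-cong = cong₂ _+_ }
                ; assoc = +-assoc }
              ; identity = +-identityˡ , λ x → trans (+-comm x 0r) (+-identityˡ x) }
            ; inverse = +-inverseˡ , λ x → trans (+-comm x (- x)) (+-inverseˡ x)
            ; ⁻¹-cong = cong -_ }
          ; comm = +-comm }
        ; *-cong = cong₂ _*_
        ; *-assoc = *-assoc
        ; *-identity = *-identityˡ , λ x → trans (*-comm x 1r) (*-identityˡ x)
        ; distrib = distribˡ , λ x y z →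
            trans (*-comm (y + z) x) (trans (distribˡ x y z) (cong₂ _+_ (*-comm x y) (*-comm x z))) }
      ; *-comm = *-comm } }

  open CommutativeRing commutativeRing public
    using (+-identityʳ; -‿inverseʳ; +-commutativeSemigroup)
  open RingProperties (CommutativeRing.ring commutativeRing) public
    using (-1*x≈-x; -‿involutive; xyx⁻¹≈y)
  open CommutativeSemigroupProperties +-commutativeSemigroup public
    using (x∙yz≈y∙xz; x∙yz≈yx∙z; xy∙z≈x∙zy)

  ≤-reflexive : ∀ {x y} → x ≡ y → x ≤ y
  ≤-reflexive refl = ≤-refl _

  ≤-poset : Poset 0ℓ 0ℓ 0ℓ
  ≤-poset = record
    { Carrier = R ; _≈_ = _≡_ ; _≤_ = _≤_
    ; isPartialOrder = record
      { isPreorder = record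
        { isEquivalence = isEquivalence
        ; reflexive = ≤-reflexive
        ; trans = ≤-trans }
      ; antisym = ≤-antisym } }

  module ≤-Reasoning = PosetReasoning ≤-poset
  open ≤-Reasoning

  infixl 6 _-_
  _-_ : R → R → R
  x - y = x + - y

  x+y-y≡x : ∀ x y → x + y - y ≡ x
  x+y-y≡x x y = trans (cong (_- y) (+-comm x y)) (xyx⁻¹≈y y x)

  x+[y-x]≡y : ∀ x y → x + (y - x) ≡ y
  x+[y-x]≡y x y = begin-equality
    x + (y - x)  ≡⟨ x∙yz≈y∙xz x y (- x) ⟩
    y + (x - x)  ≡⟨ cong (y +_) (-‿inverseʳ x) ⟩
    y + 0r       ≡⟨ +-identityʳ y ⟩
    y            ∎

  -1*-1≡1 : (- 1r) * (- 1r) ≡ 1r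
  -1*-1≡1 = trans (-1*x≈-x (- 1r)) (-‿involutive 1r)

  +-monoʳ-≤ : ∀ {x y} z → x ≤ y → z + x ≤ z + y
  +-monoʳ-≤ {x} {y} z x≤y = begin
    z + x ≡⟨ +-comm z x ⟩
    x + z ≤⟨ +-mono-≤ z x≤y ⟩
    y + z ≡⟨ +-comm y z ⟩
    z + y ∎

  x+y≤z⇒x≤z-y : ∀ {x y z} → x + y ≤ z → x ≤ z - y
  x+y≤z⇒x≤z-y {x} {y} {z} x+y≤z = begin
    x         ≡⟨ x+y-y≡x x y ⟨
    x + y - y ≤⟨ +-mono-≤ (- y) x+y≤z ⟩
    z - y     ∎

  x≤y⇒0≤y-x : ∀ {x y} → x ≤ y → 0r ≤ y - x
  x≤y⇒0≤y-x x≤y = x+y≤z⇒x≤z-y (subst (_≤ _) (sym (+-identityˡ _)) x≤y)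

  +-cancelʳ-≤ : ∀ {x y} z → x + z ≤ y + z → x ≤ y
  +-cancelʳ-≤ {x} {y} z x+z≤y+z = subst (x ≤_) (x+y-y≡x y z) (x+y≤z⇒x≤z-y x+z≤y+z)

  x≤x+y : ∀ {x y} → 0r ≤ y → x ≤ x + y
  x≤x+y {x} {y} 0≤y = begin
    x      ≡⟨ +-identityʳ x ⟨
    x + 0r ≤⟨ +-monoʳ-≤ x 0≤y ⟩
    x + y  ∎

  +-nonneg : ∀ {x y} → 0r ≤ x → 0r ≤ y → 0r ≤ x + y
  +-nonneg 0≤x 0≤y = ≤-trans 0≤x (x≤x+y 0≤y)

  0≤1 : 0r ≤ 1r
  0≤1 with ≤-total 0r 1r
  ... | inj₁ 0≤1 = 0≤1
  ... | inj₂ 1≤0 = subst (0r ≤_) -1*-1≡1 (*-nonneg 0≤-1 0≤-1)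
    where
    0≤-1 : 0r ≤ - 1r
    0≤-1 = begin
      0r          ≡⟨ -‿inverseʳ 1r ⟨
      1r + - 1r   ≤⟨ +-mono-≤ (- 1r) 1≤0 ⟩
      0r + - 1r   ≡⟨ +-identityˡ (- 1r) ⟩
      - 1r        ∎

  fromℕ-+ : ∀ m k → fromℕ (m ℕ.+ k) ≡ fromℕ m + fromℕ k
  fromℕ-+ zero    k = sym (+-identityˡ (fromℕ k))
  fromℕ-+ (suc m) k = trans (cong (1r +_) (fromℕ-+ m k)) (sym (+-assoc 1r _ _))

  fromℕ-nonneg : ∀ m → 0r ≤ fromℕ m
  fromℕ-nonneg zero    = ≤-refl 0r
  fromℕ-nonneg (suc m) = +-nonneg 0≤1 (fromℕ-nonneg m)

  fromℕ-mono : ∀ {m k} → m ℕ.≤ k → fromℕ m ≤ fromℕ k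
  fromℕ-mono {m} m≤k with ℕ.m≤n⇒∃[o]m+o≡n m≤k
  ... | o , refl = subst (fromℕ m ≤_) (sym (fromℕ-+ m o)) (x≤x+y (fromℕ-nonneg o))

  fromℕ≤fromℤ⊎fromℤ+1≤fromℕ : ∀ m c → fromℕ m ≤ fromℤ c ⊎ fromℤ c + 1r ≤ fromℕ m
  fromℕ≤fromℤ⊎fromℤ+1≤fromℕ m (ℤ.+ k) with ℕ.≤-<-connex m k
  ... | inj₁ m≤k = inj₁ (fromℕ-mono m≤k)
  ... | inj₂ k<m = inj₂ (subst (_≤ fromℕ m) (+-comm 1r (fromℕ k)) (fromℕ-mono k<m))
  fromℕ≤fromℤ⊎fromℤ+1≤fromℕ m -[1+ k ] = inj₂ (begin
    - (1r + fromℕ k) + 1r               ≤⟨ +-monoʳ-≤ (- (1r + fromℕ k)) (x≤x+y (fromℕ-nonneg k)) ⟩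
    - (1r + fromℕ k) + (1r + fromℕ k)   ≡⟨ +-inverseˡ (1r + fromℕ k) ⟩
    0r                                  ≤⟨ fromℕ-nonneg m ⟩
    fromℕ m                             ∎)

  fromℕ≤fromℤ+α⇒fromℕ≤fromℤ : ∀ m c {α} → α < 1r →
                              fromℕ m ≤ fromℤ c + α → fromℕ m ≤ fromℤ c
  fromℕ≤fromℤ+α⇒fromℕ≤fromℤ m c {α} (α≤1 , α≢1) m≤c+α
    with fromℕ≤fromℤ⊎fromℤ+1≤fromℕ m c
  ... | inj₁ m≤c   = m≤c
  ... | inj₂ c+1≤m = ⊥-elim (α≢1 (≤-antisym α≤1 (+-cancelʳ-≤ (fromℤ c) (begin
    1r + fromℤ c ≡⟨ +-comm 1r (fromℤ c) ⟩
    fromℤ c + 1r ≤⟨ c+1≤m ⟩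
    fromℕ m      ≤⟨ m≤c+α ⟩
    fromℤ c + α  ≡⟨ +-comm (fromℤ c) α ⟩
    α + fromℤ c  ∎))))

updateAt-preserves : ∀ {n} {A : Set} (P : A → Set) (f : Fin n → A) u {c} →
                     (∀ x → P (f x)) → P c → ∀ x → P (updateAt f u (const c) x)
updateAt-preserves P f u Pf Pc x with x ≟ u
... | yes refl = subst P (sym (updateAt-updates x f)) Pc
... | no x≢u   = subst P (sym (updateAt-minimal x u f x≢u)) (Pf x)

module SumProperties (ℝ : RealField) where
  open RealField ℝ
  open OrderedFieldProperties ℝ
  open ≤-Reasoning

  sumFin-nonneg : ∀ {n} (f : Fin n → R) → (∀ x → 0r ≤ f x) → 0r ≤ sumFin f
  sumFin-nonneg {zero}  f f≥0 = ≤-refl 0r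
  sumFin-nonneg {suc n} f f≥0 = +-nonneg (f≥0 zero) (sumFin-nonneg (tail f) (f≥0 ∘ suc))

  sumFin-const-0 : ∀ n → sumFin {n} (const 0r) ≡ 0r
  sumFin-const-0 zero    = refl
  sumFin-const-0 (suc n) = trans (+-identityˡ _) (sumFin-const-0 n)

  sumFin-updateAt : ∀ {n} {A : Set} (h : A → R) (f : Fin n → A) u c →
                    sumFin (h ∘ updateAt f u (const c)) + h (f u) ≡ h c + sumFin (h ∘ f)
  sumFin-updateAt h f zero    c = xy∙z≈x∙zy (h c) _ (h (f zero))
  sumFin-updateAt h f (suc u) c = begin-equality
    (h (f zero) + sumFin (h ∘ updateAt (tail f) u (const c))) + h (f (suc u))
      ≡⟨ +-assoc (h (f zero)) _ _ ⟩
    h (f zero) + (sumFin (h ∘ updateAt (tail f) u (const c)) + h (f (suc u)))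
      ≡⟨ cong (h (f zero) +_) (sumFin-updateAt h (tail f) u c) ⟩
    h (f zero) + (h c + sumFin (h ∘ tail f))
      ≡⟨ x∙yz≈y∙xz (h (f zero)) (h c) _ ⟩
    h c + (h (f zero) + sumFin (h ∘ tail f))
      ∎

  sumFin≡at+rest : ∀ {n} (f : Fin n → R) u → sumFin f ≡ f u + sumFin (updateAt f u (const 0r))
  sumFin≡at+rest f u = begin-equality
    sumFin f                                     ≡⟨ +-identityˡ (sumFin f) ⟨
    0r + sumFin f                                ≡⟨ sumFin-updateAt id f u 0r ⟨
    sumFin (updateAt f u (const 0r)) + f u       ≡⟨ +-comm _ (f u) ⟩
    f u + sumFin (updateAt f u (const 0r))       ∎

module Rounding (ℝ : RealField) {n : ℕ} (G : Graph n) (w : Fin n → Fin n → ℕ) where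
  open RealField ℝ
  open OrderedFieldProperties ℝ
  open SumProperties ℝ
  open ≤-Reasoning

  private variable
    E : Fin n → Fin n → Set
    u t : Fin n

  head∈vertices : (W : Walk E u t) → u ∈ vertices W
  head∈vertices here       = here refl
  head∈vertices (step _ _) = here refl

  sumAlong : (Fin n → R) → Walk E u t → R
  sumAlong f (here {v})     = f v
  sumAlong f (step {u} _ W) = f u + sumAlong f W

  sumAlong-cong : ∀ {f h : Fin n → R} (W : Walk E u t) →
                  All (λ x → f x ≡ h x) (vertices W) → sumAlong f W ≡ sumAlong h W
  sumAlong-cong here       (f≡h ∷ _)    = f≡h
  sumAlong-cong (step _ W) (f≡h ∷ rest) = cong₂ _+_ f≡h (sumAlong-cong W rest)

  sumAlong≤sumFin : (f : Fin n → R) → (∀ x → 0r ≤ f x) →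
                    (W : Walk E u t) → Unique (vertices W) → sumAlong f W ≤ sumFin f
  sumAlong≤sumFin f f≥0 (here {v}) _ = begin
    f v                  ≤⟨ x≤x+y (sumFin-nonneg f₀ f₀≥0) ⟩
    f v + sumFin f₀      ≡⟨ sumFin≡at+rest f v ⟨
    sumFin f             ∎
    where
    f₀ = updateAt f v (const 0r)
    f₀≥0 = updateAt-preserves (0r ≤_) f v f≥0 (≤-refl 0r)
  sumAlong≤sumFin f f≥0 (step {u} _ W) (u∉W ∷ W-unique) = begin
    f u + sumAlong f W   ≡⟨ cong (f u +_) (sumAlong-cong W f≡f₀) ⟩
    f u + sumAlong f₀ W  ≤⟨ +-monoʳ-≤ (f u) (sumAlong≤sumFin f₀ f₀≥0 W W-unique) ⟩
    f u + sumFin f₀      ≡⟨ sumFin≡at+rest f u ⟨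
    sumFin f             ∎
    where
    f₀ = updateAt f u (const 0r)
    f₀≥0 = updateAt-preserves (0r ≤_) f u f≥0 (≤-refl 0r)
    f≡f₀ : All (λ x → f x ≡ f₀ x) (vertices W)
    f≡f₀ = All.map (λ {x} u≢x → sym (updateAt-minimal x u f (≢-sym u≢x))) u∉W

  greedy : Walk E u t → ℕ → Fin n → ℕ
  greedy (here {v})         a = updateAt (const 0) v (const a)
  greedy (step {u} {v} _ W) a = updateAt (greedy W (w u v ∸ a)) u (const a)

  greedyCost : Walk E u t → ℕ → ℕ
  greedyCost here               a = a
  greedyCost (step {u} {v} _ W) a = a ℕ.+ greedyCost W (w u v ∸ a)

  greedy-head : (W : Walk E u t) (a : ℕ) → greedy W a u ≡ a
  greedy-head (here {v})     a = updateAt-updates v (const 0)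
  greedy-head (step {u} _ W) a = updateAt-updates u (greedy W _)

  greedy-outside : (W : Walk E u t) (a : ℕ) {x : Fin n} →
                   All (x ≢_) (vertices W) → greedy W a x ≡ 0
  greedy-outside (here {v})     a {x} (x≢v ∷ _)    = updateAt-minimal x v (const 0) x≢v
  greedy-outside (step {u} _ W) a {x} (x≢u ∷ rest) =
    trans (updateAt-minimal x u (greedy W _) x≢u) (greedy-outside W _ rest)

  sumFin-greedy : (W : Walk E u t) (a : ℕ) → Unique (vertices W) →
                  sumFin (fromℕ ∘ greedy W a) ≡ fromℕ (greedyCost W a)
  sumFin-greedy (here {v}) a _ = begin-equality
    sumFin (fromℕ ∘ updateAt (const 0) v (const a))        ≡⟨ +-identityʳ _ ⟨
    sumFin (fromℕ ∘ updateAt (const 0) v (const a)) + 0r   ≡⟨ sumFin-updateAt fromℕ (const 0) v a ⟩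
    fromℕ a + sumFin {n} (const 0r)                        ≡⟨ cong (fromℕ a +_) (sumFin-const-0 n) ⟩
    fromℕ a + 0r                                           ≡⟨ +-identityʳ _ ⟩
    fromℕ a                                                ∎
  sumFin-greedy (step {u} {v} e W) a (u∉W ∷ W-unique) = begin-equality
    Σgreedy                                    ≡⟨ +-identityʳ _ ⟨
    Σgreedy + 0r                               ≡⟨ cong (λ k → Σgreedy + fromℕ k) (greedy-outside W b u∉W) ⟨
    Σgreedy + fromℕ (greedy W b u)             ≡⟨ sumFin-updateAt fromℕ (greedy W b) u a ⟩
    fromℕ a + sumFin (fromℕ ∘ greedy W b)      ≡⟨ cong (fromℕ a +_) (sumFin-greedy W b W-unique) ⟩
    fromℕ a + fromℕ (greedyCost W b)           ≡⟨ fromℕ-+ a _ ⟨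
    fromℕ (greedyCost (step e W) a)            ∎
    where
    b = w u v ∸ a
    Σgreedy = sumFin (fromℕ ∘ greedy (step e W) a)

  greedy-installs : (∀ {x y} → E x y → Graph.Adj G x y) →
                    (W : Walk E u t) → Unique (vertices W) → (a : ℕ) (q : Fin n → ℕ) →
                    (∀ x → x ∈ vertices W → q x ≡ greedy W a x) →
                    Σ[ W′ ∈ Walk (Installed ℝ G w (fromℕ ∘ q)) u t ] vertices W′ ≡ vertices W
  greedy-installs adj here _ a q _ = here , refl
  greedy-installs adj (step {u} {v} e W) (u∉W ∷ W-unique) a q q≡greedy =
    Product.map (step (adj e , installed)) (cong (u ∷_))
                (greedy-installs adj W W-unique b q q≡greedy-tail)
    where
    b = w u v ∸ a
    q≡greedy-tail : ∀ x → x ∈ vertices W → q x ≡ greedy W b x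
    q≡greedy-tail x x∈W = trans (q≡greedy x (there x∈W))
                                (updateAt-minimal x u (greedy W b) (≢-sym (All.lookup u∉W x∈W)))
    q-at-u : q u ≡ a
    q-at-u = trans (q≡greedy u (here refl)) (updateAt-updates u (greedy W b))
    q-at-v : q v ≡ b
    q-at-v = trans (q≡greedy-tail v (head∈vertices W)) (greedy-head W b)
    installed : fromℕ (w u v) ≤ fromℕ (q u) + fromℕ (q v)
    installed = begin
      fromℕ (w u v)               ≤⟨ fromℕ-mono (ℕ.m≤n+m∸n (w u v) a) ⟩
      fromℕ (a ℕ.+ b)             ≡⟨ cong fromℕ (cong₂ ℕ._+_ q-at-u q-at-v) ⟨
      fromℕ (q u ℕ.+ q v)         ≡⟨ fromℕ-+ (q u) (q v) ⟩
      fromℕ (q u) + fromℕ (q v)   ∎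

  greedyCost≤sumAlong : (p : Fin n → R) → (∀ x → 0r ≤ p x) →
                        (W : Walk (Installed ℝ G w p) u t) (a : ℕ) {r : R} → 0r ≤ r →
                        fromℕ a ≤ p u + r → fromℕ (greedyCost W a) ≤ sumAlong p W + r
  greedyCost≤sumAlong p p≥0 here a r≥0 a≤pu+r = a≤pu+r
  greedyCost≤sumAlong p p≥0 (step {u} {v} (_ , w≤pu+pv) W) a {r} r≥0 a≤pu+r = begin
    fromℕ (a ℕ.+ greedyCost W b)         ≡⟨ fromℕ-+ a _ ⟩
    A + fromℕ (greedyCost W b)           ≤⟨ +-monoʳ-≤ A IH ⟩
    A + (sumAlong p W + slack)           ≡⟨ x∙yz≈y∙xz A (sumAlong p W) slack ⟩
    sumAlong p W + (A + slack)           ≡⟨ cong (sumAlong p W +_) (x+[y-x]≡y A (p u + r)) ⟩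
    sumAlong p W + (p u + r)             ≡⟨ x∙yz≈yx∙z (sumAlong p W) (p u) r ⟩
    p u + sumAlong p W + r               ∎
    where
    A = fromℕ a
    b = w u v ∸ a
    slack = p u + r - A
    slack≥0 : 0r ≤ slack
    slack≥0 = x≤y⇒0≤y-x a≤pu+r
    b≤pv+slack : fromℕ b ≤ p v + slack
    b≤pv+slack with ℕ.≤-<-connex (w u v) a
    ... | inj₁ w≤a = subst (_≤ p v + slack) (cong fromℕ (sym (ℕ.m≤n⇒m∸n≡0 w≤a)))
                           (+-nonneg (p≥0 v) slack≥0)
    ... | inj₂ a<w = subst (fromℕ b ≤_) (+-assoc (p v) (p u + r) (- A)) (x+y≤z⇒x≤z-y (begin
      fromℕ b + A            ≡⟨ fromℕ-+ b a ⟨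
      fromℕ (b ℕ.+ a)        ≡⟨ cong fromℕ (ℕ.m∸n+n≡m (ℕ.<⇒≤ a<w)) ⟩
      fromℕ (w u v)          ≤⟨ w≤pu+pv ⟩
      p u + p v              ≡⟨ +-comm (p u) (p v) ⟩
      p v + p u              ≤⟨ +-monoʳ-≤ (p v) (x≤x+y r≥0) ⟩
      p v + (p u + r)        ∎))
    IH : fromℕ (greedyCost W b) ≤ sumAlong p W + slack
    IH = greedyCost≤sumAlong p p≥0 W b slack≥0 b≤pv+slack

  MinInstPath-mono : ∀ {s t X Y} → X ≤ Y → MinInstPath ℝ G w s t X → MinInstPath ℝ G w s t Y
  MinInstPath-mono X≤Y (p , p≥0 , Σp≤X , P) = p , p≥0 , ≤-trans Σp≤X X≤Y , P

  integralSolution : ∀ {s t X} → MinInstPath ℝ G w s t X →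
                     ∃[ N ] (fromℕ N ≤ X × MinInstPath ℝ G w s t (fromℕ N))
  integralSolution {s} {t} {X} (p , p≥0 , Σp≤X , P) =
    greedyCost W 0 , cost≤X ,
    q , fromℕ-nonneg ∘ greedy W 0 , ≤-reflexive (sumFin-greedy W 0 W-unique) , Q
    where
    W = Path.walk P
    W-unique = Path.distinct P
    q : Fin n → R
    q = fromℕ ∘ greedy W 0
    cost≤X : fromℕ (greedyCost W 0) ≤ X
    cost≤X = begin
      fromℕ (greedyCost W 0)  ≤⟨ greedyCost≤sumAlong p p≥0 W 0 (≤-refl 0r) (+-nonneg (p≥0 s) (≤-refl 0r)) ⟩
      sumAlong p W + 0r       ≡⟨ +-identityʳ _ ⟩
      sumAlong p W            ≤⟨ sumAlong≤sumFin p p≥0 W W-unique ⟩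
      sumFin p                ≤⟨ Σp≤X ⟩
      X                       ∎
    Q : Path (Installed ℝ G w q) s t
    Q with greedy-installs proj₁ W W-unique 0 (greedy W 0) (λ _ _ → refl)
    ... | W′ , W′≡W = record { walk = W′ ; distinct = subst Unique (sym W′≡W) W-unique }

mainTheorem7 : (ℝ : RealField) → let open RealField ℝ in
    ∀ {n} (G : Graph n) (w : Fin n → Fin n → ℕ) →
    (∀ u v → w u v ≡ w v u) →
    (∀ u v → Graph.Adj G u v → w u v ≥ 1) →
    (s t : Fin n) (C : ℤ) (α : R) → 0r ≤ α → α < 1r →
    MinInstPath ℝ G w s t (fromℤ C) ⇔ MinInstPath ℝ G w s t (fromℤ C + α)
mainTheorem7 ℝ G w _ _ s t C α 0≤α α<1 = mk⇔ (MinInstPath-mono {s} {t} {fromℤ C} (x≤x+y 0≤α)) round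
  where
  open RealField ℝ
  open OrderedFieldProperties ℝ
  open Rounding ℝ G w
  round : MinInstPath ℝ G w s t (fromℤ C + α) → MinInstPath ℝ G w s t (fromℤ C)
  round solution with integralSolution {s} {t} solution
  ... | N , N≤C+α , integral =
    MinInstPath-mono {s} {t} {fromℕ N} (fromℕ≤fromℤ+α⇒fromℕ≤fromℤ N C α<1 N≤C+α) integral
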